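{- Let $H$ be a complete bipartite graph whose edges are coloured red and blue. Then one of the following holds: (a) there is a monochromatic component that is spanning in $H$; (b) the colouring of $H$ is a $V$-colouring; (c) the colouring of $H$ is split.
   Context: A bipartite graph $H$ has biparts (partition classes) $\overline{H}$ (top) and $\underline{H}$ (bottom); subgraphs inherit these biparts. A bipartite graph is trivial if one of its biparts has no vertices. A red (blue) component is a connected component of the spanning subgraph of $H$ formed by the red (blue) edges. A subgraph (or union of subgraphs) is spanning in $H$ if it contains all vertices of $H$. The colouring is a $V$-colouring if there are a red component $R$ and a blue component $B$ such that: each of $R$ and $B$ is non-trivial; $R\cup B$ is spanning in $H$; and either the top bipart of $R\cap B$ equals $\overline{H}$ or the bottom bipart of $R\cap B$ equals $\underline{H}$. The colouring is split if all monochromatic components are non-trivial and each colour has exactly two monochromatic components. -}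

module Defs where

open import Data.Nat using (ℕ)
open import Data.Fin using (Fin)
open import Data.Sum using (_⊎_; inj₁; inj₂)
open import Data.Product using (Σ; ∃; _×_; _,_)
open import Relation.Nullary using (¬_)
open import Relation.Binary.PropositionalEquality using (_≡_)
open import Relation.Binary.Construct.Closure.ReflexiveTransitive using (Star)

data Colour : Set where
  red blue : Colour

-- A red/blue edge-colouring of the complete bipartite graph K_{m,n}
-- with top bipart Fin m and bottom bipart Fin n: every pair (i , j)
-- is an edge, coloured  c i j.
Colouring : ℕ → ℕ → Set
Colouring m n = Fin m → Fin n → Colour

Vertex : ℕ → ℕ → Set
Vertex m n = Fin m ⊎ Fin n

top : ∀ {m n} → Fin m → Vertex m n
top = inj₁

bot : ∀ {m n} → Fin n → Vertex m n
bot = inj₂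

data Adj {m n : ℕ} (c : Colouring m n) (k : Colour) : Vertex m n → Vertex m n → Set where
  tb : ∀ i j → c i j ≡ k → Adj c k (top i) (bot j)
  bt : ∀ i j → c i j ≡ k → Adj c k (bot j) (top i)

Conn : ∀ {m n} → Colouring m n → Colour → Vertex m n → Vertex m n → Set
Conn c k = Star (Adj c k)

-- The colour-k component of v is the set of w with Conn c k v w.
-- It is non-trivial iff it contains both a top and a bottom vertex.
NonTrivial : ∀ {m n} → Colouring m n → Colour → Vertex m n → Set
NonTrivial c k v = (∃ λ i → Conn c k v (top i)) × (∃ λ j → Conn c k v (bot j))

HasSpanningMonoComponent : ∀ {m n} → Colouring m n → Set
HasSpanningMonoComponent {m} {n} c =
  Σ Colour λ k → Σ (Vertex m n) λ v → ∀ w → Conn c k v w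

IsVColouring : ∀ {m n} → Colouring m n → Set
IsVColouring {m} {n} c =
  Σ (Vertex m n) λ r → Σ (Vertex m n) λ b →
    NonTrivial c red r × NonTrivial c blue b ×
    (∀ w → Conn c red r w ⊎ Conn c blue b w) ×
    ((∀ i → Conn c red r (top i) × Conn c blue b (top i)) ⊎
     (∀ j → Conn c red r (bot j) × Conn c blue b (bot j)))

ExactlyTwoComponents : ∀ {m n} → Colouring m n → Colour → Set
ExactlyTwoComponents {m} {n} c k =
  Σ (Vertex m n) λ v → Σ (Vertex m n) λ w →
    ¬ Conn c k v w × (∀ u → Conn c k v u ⊎ Conn c k w u)

IsSplit : ∀ {m n} → Colouring m n → Set
IsSplit {m} {n} c =
  (∀ k (v : Vertex m n) → NonTrivial c k v) ×
  ExactlyTwoComponents c red × ExactlyTwoComponents c blue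

-- If some vertex v has a trivial k-component, all its edges have the other colour k′, so v's
-- k′-component contains the whole opposite side; it fails to span only if some vertex on v's
-- side sees only colour k, and those two monochromatic stars form a V-colouring.
-- Otherwise all components are non-trivial. If some colour k had three components, any top
-- vertex of one and bottom vertex of another are joined by a k′-edge, and a short case analysis
-- shows that the k′-component of a top vertex spans. So each colour has one spanning component
-- or exactly two, and in the latter case the colouring is split.
module Submission where

open import Defs
open import Data.Nat using (ℕ; suc)
open import Data.Fin using (Fin; zero; punchIn; punchOut; splitAt; join)
open import Data.Fin.Properties
  using (punchInᵢ≢i; punchIn-punchOut; any?; all?; ¬∀⟶∃¬; splitAt-join) renaming (_≟_ to _≟ᶠ_)
open import Data.Sum using (_⊎_; inj₁; inj₂; swap; map₂) renaming (map to map-⊎)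
open import Data.Sum.Properties using (swap-involutive)
open import Data.Product using (∃; _×_; _,_)
open import Data.Empty using (⊥-elim)
open import Function using (_on_)
open import Level using (Level)
open import Relation.Nullary using (¬_; Dec; yes; no)
open import Relation.Nullary.Decidable using (_×-dec_; _⊎-dec_; map′)
open import Relation.Unary using (Pred)
open import Relation.Binary using (Rel)
open import Relation.Binary.Definitions using (Decidable)
open import Relation.Binary.PropositionalEquality using (_≡_; refl; sym; subst; subst₂)
open import Relation.Binary.Construct.Closure.ReflexiveTransitive using (Star; ε; _◅_; _◅◅_; gmap; reverse)

private
  variable
    ℓ : Level
    m n : ℕ

_without_ : ∀ {N} → Rel (Fin (suc N)) ℓ → Fin (suc N) → Rel (Fin N) ℓ
(E without v) = E on punchIn v

-- Cut a walk ending outside v at its last visit to v (if any).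
Star-lastVisit : ∀ {N} {E : Rel (Fin (suc N)) ℓ} v w {a} → Star E a (punchIn v w) →
  (∃ λ a′ → a ≡ punchIn v a′ × Star (E without v) a′ w) ⊎
  (∃ λ u → E v (punchIn v u) × Star (E without v) u w)
Star-lastVisit v w ε = inj₁ (w , refl , ε)
Star-lastVisit {E = E} v w {a} (e ◅ walk) with Star-lastVisit v w walk
... | inj₂ visit = inj₂ visit
... | inj₁ (b , refl , rest) with v ≟ᶠ a
...   | yes refl = inj₂ (b , e , rest)
...   | no v≢a = inj₁ (punchOut v≢a , sym (punchIn-punchOut v≢a) ,
                       subst (λ x → E x (punchIn v b)) (sym (punchIn-punchOut v≢a)) e ◅ rest)

Star-dec : ∀ {N} {E : Rel (Fin N) ℓ} → Decidable E → Decidable (Star E)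
Star-dec {N = suc N} {E = E} E? v w with v ≟ᶠ w
... | yes refl = yes ε
... | no v≢w with any? (λ u → E? v (punchIn v u) ×-dec Star-dec (λ x y → E? (punchIn v x) (punchIn v y)) u w′)
  where w′ = punchOut v≢w
...   | yes (u , e , walk) = yes (subst (Star E v) (punchIn-punchOut v≢w) (e ◅ gmap (punchIn v) (λ x → x) walk))
...   | no ¬step = no λ walk → refute (Star-lastVisit v (punchOut v≢w)
                                         (subst (Star E v) (sym (punchIn-punchOut v≢w)) walk))
  where
  refute : ¬ ((∃ λ a′ → v ≡ punchIn v a′ × _) ⊎ (∃ λ u → E v (punchIn v u) × _))
  refute (inj₁ (a′ , v≡ , _)) = punchInᵢ≢i v a′ (sym v≡)
  refute (inj₂ visit) = ¬step visit

Star-dec-retract : ∀ {a b} {A : Set a} {B : Set b} {E : Rel A ℓ} (f : A → B) (g : B → A) →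
  (∀ x → g (f x) ≡ x) → Decidable (Star (E on g)) → Decidable (Star E)
Star-dec-retract {E = E} f g gf≡id Eg? x y = map′ from to (Eg? (f x) (f y))
  where
  to : Star E x y → Star (E on g) (f x) (f y)
  to = gmap f (λ {u} {v} e → subst₂ E (sym (gf≡id u)) (sym (gf≡id v)) e)
  from : Star (E on g) (f x) (f y) → Star E x y
  from walk = subst₂ (Star E) (gf≡id x) (gf≡id y) (gmap g (λ e → e) walk)

all⊎counterexample : ∀ {p} {P : Pred (Vertex m n) p} → (∀ v → Dec (P v)) →
  (∀ v → P v) ⊎ ∃ λ v → ¬ P v
all⊎counterexample {m} {n} {P = P} P? with all? (λ i → P? (top i)) | all? (λ j → P? (bot j))
... | no ¬all | _ = let (i , ¬Pi) = ¬∀⟶∃¬ m (λ i → P (top i)) (λ i → P? (top i)) ¬all in inj₂ (top i , ¬Pi)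
... | yes _ | no ¬all = let (j , ¬Pj) = ¬∀⟶∃¬ n (λ j → P (bot j)) (λ j → P? (bot j)) ¬all in inj₂ (bot j , ¬Pj)
... | yes allTop | yes allBot = inj₁ λ { (inj₁ i) → allTop i ; (inj₂ j) → allBot j }

_≟ᶜ_ : Decidable {A = Colour} _≡_
red ≟ᶜ red = yes refl
red ≟ᶜ blue = no λ ()
blue ≟ᶜ red = no λ ()
blue ≟ᶜ blue = yes refl

flip : Colour → Colour
flip red = blue
flip blue = red

≢⇒≡flip : ∀ {x k} → ¬ x ≡ k → x ≡ flip k
≢⇒≡flip {red} {red} x≢k = ⊥-elim (x≢k refl)
≢⇒≡flip {red} {blue} _ = refl
≢⇒≡flip {blue} {red} _ = refl
≢⇒≡flip {blue} {blue} x≢k = ⊥-elim (x≢k refl)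

module _ (c : Colouring m n) where

  Adj-sym : ∀ {k x y} → Adj c k x y → Adj c k y x
  Adj-sym (tb i j e) = bt i j e
  Adj-sym (bt i j e) = tb i j e

  Conn-sym : ∀ {k x y} → Conn c k x y → Conn c k y x
  Conn-sym = reverse Adj-sym

  Adj-dec : ∀ k → Decidable (Adj c k)
  Adj-dec k (inj₁ i) (inj₁ i′) = no λ ()
  Adj-dec k (inj₂ j) (inj₂ j′) = no λ ()
  Adj-dec k (inj₁ i) (inj₂ j) with c i j ≟ᶜ k
  ... | yes e = yes (tb i j e)
  ... | no e≢ = no λ { (tb _ _ e) → e≢ e }
  Adj-dec k (inj₂ j) (inj₁ i) with c i j ≟ᶜ k
  ... | yes e = yes (bt i j e)
  ... | no e≢ = no λ { (bt _ _ e) → e≢ e }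

  Conn-dec : ∀ k → Decidable (Conn c k)
  Conn-dec k = Star-dec-retract (join m n) (splitAt m) (splitAt-join m n)
                 (Star-dec (λ x y → Adj-dec k (splitAt m x) (splitAt m y)))

  NonTrivial-dec : ∀ k v → Dec (NonTrivial c k v)
  NonTrivial-dec k v = any? (λ i → Conn-dec k v (top i)) ×-dec any? (λ j → Conn-dec k v (bot j))

  separated : ∀ {k p q x y} → ¬ Conn c k p q → Conn c k p x → Conn c k q y → ¬ Conn c k x y
  separated ¬pq px qy xy = ¬pq (px ◅◅ xy ◅◅ Conn-sym qy)

  separated⇒flip : ∀ {k p q i j} → ¬ Conn c k p q → Conn c k p (top i) → Conn c k q (bot j) →
    c i j ≡ flip k
  separated⇒flip {i = i} {j} ¬pq pi qj = ≢⇒≡flip λ e → separated ¬pq pi qj (tb i j e ◅ ε)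

  -- Let p, q, s lie in distinct k-components, with T₁ on top in p's, B₂ at the bottom in q's
  -- and T₃, B₃ in s's. The walks below use only edges between distinct k-components.
  threeComponents⇒spanning : ∀ {k p q s} →
    ¬ Conn c k p q → ¬ Conn c k p s → ¬ Conn c k q s →
    NonTrivial c k p → NonTrivial c k q → NonTrivial c k s → HasSpanningMonoComponent c
  threeComponents⇒spanning {k} ¬pq ¬ps ¬qs ((T₁ , pT₁) , _) (_ , (B₂ , qB₂)) ((T₃ , sT₃) , (B₃ , sB₃)) =
    flip k , top T₁ , spans
    where
    ¬qp = λ qp → ¬pq (Conn-sym qp)
    ¬sp = λ sp → ¬ps (Conn-sym sp)
    ¬sq = λ sq → ¬qs (Conn-sym sq)
    spans : ∀ w → Conn c (flip k) (top T₁) w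
    spans (inj₁ t) with Conn-dec k (top t) (bot B₂)
    ... | no ¬tB₂ = tb T₁ B₂ (separated⇒flip ¬pq pT₁ qB₂) ◅ bt t B₂ (separated⇒flip ¬tB₂ ε ε) ◅ ε
    ... | yes tB₂ = tb T₁ B₃ (separated⇒flip ¬ps pT₁ sB₃)
                  ◅ bt t B₃ (separated⇒flip ¬qs (qB₂ ◅◅ Conn-sym tB₂) sB₃) ◅ ε
    spans (inj₂ b) with Conn-dec k (top T₁) (bot b)
    ... | no ¬T₁b = tb T₁ b (separated⇒flip ¬T₁b ε ε) ◅ ε
    ... | yes T₁b = tb T₁ B₂ (separated⇒flip ¬pq pT₁ qB₂)
                  ◅ bt T₃ B₂ (separated⇒flip ¬sq sT₃ qB₂)
                  ◅ tb T₃ b (separated⇒flip ¬sp sT₃ (pT₁ ◅◅ T₁b)) ◅ ε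

  nonTrivial⇒spanning⊎twoComponents : ∀ k (t : Vertex m n) → (∀ v → NonTrivial c k v) →
    HasSpanningMonoComponent c ⊎ ExactlyTwoComponents c k
  nonTrivial⇒spanning⊎twoComponents k t nonTrivial with all⊎counterexample (Conn-dec k t)
  ... | inj₁ spans = inj₁ (k , t , spans)
  ... | inj₂ (w , ¬tw) with all⊎counterexample (λ u → Conn-dec k t u ⊎-dec Conn-dec k w u)
  ...   | inj₁ covers = inj₂ (t , w , ¬tw , covers)
  ...   | inj₂ (u , ¬tw⊎wu) = inj₁ (threeComponents⇒spanning ¬tw (λ tu → ¬tw⊎wu (inj₁ tu))
                                      (λ wu → ¬tw⊎wu (inj₂ wu)) (nonTrivial t) (nonTrivial w) (nonTrivial u))

module _ (c : Colouring m (suc n)) where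

  redStar+blueStar⇒V : ∀ {r b} → (∀ j → c r j ≡ red) → (∀ j → c b j ≡ blue) → IsVColouring c
  redStar+blueStar⇒V {r} {b} allRed allBlue =
    top r , top b , ((r , ε) , (zero , edge r allRed)) , ((b , ε) , (zero , edge b allBlue)) ,
    covers , inj₂ (λ j → edge r allRed , edge b allBlue)
    where
    edge : ∀ {k} i → (∀ j → c i j ≡ k) → ∀ {j} → Conn c k (top i) (bot j)
    edge i allK {j} = tb i j (allK j) ◅ ε
    covers : ∀ w → Conn c red (top r) w ⊎ Conn c blue (top b) w
    covers (inj₂ j) = inj₁ (edge r allRed)
    covers (inj₁ t) with c t zero in e
    ... | red = inj₁ (edge r allRed ◅◅ bt t zero e ◅ ε)
    ... | blue = inj₂ (edge b allBlue ◅◅ bt t zero e ◅ ε)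

  star⇒spanning⊎V : ∀ k i → (∀ j → c i j ≡ flip k) → HasSpanningMonoComponent c ⊎ IsVColouring c
  star⇒spanning⊎V k i allFlip with any? (λ i′ → all? (λ j → c i′ j ≟ᶜ k))
  ... | yes (i′ , allK) = inj₂ (V k allK allFlip)
    where
    V : ∀ k → (∀ j → c i′ j ≡ k) → (∀ j → c i j ≡ flip k) → IsVColouring c
    V red = redStar+blueStar⇒V
    V blue allBlue allRed = redStar+blueStar⇒V allRed allBlue
  ... | no ¬allK = inj₁ (flip k , top i , spans)
    where
    spans : ∀ w → Conn c (flip k) (top i) w
    spans (inj₂ j) = tb i j (allFlip j) ◅ ε
    spans (inj₁ t) with ¬∀⟶∃¬ _ (λ j → c t j ≡ k) (λ j → c t j ≟ᶜ k) (λ allK → ¬allK (t , allK))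
    ... | j , e≢k = tb i j (allFlip j) ◅ bt t j (≢⇒≡flip e≢k) ◅ ε

transpose : Colouring m n → Colouring n m
transpose c j i = c i j

-- Since transpose (transpose c) is c by η, this also transports walks back from transpose c.
Conn-transpose : ∀ {c : Colouring m n} {k x y} → Conn c k x y → Conn (transpose c) k (swap x) (swap y)
Conn-transpose = gmap swap λ { (tb i j e) → bt j i e ; (bt i j e) → tb j i e }

module _ (c : Colouring m n) where

  spanning-transpose : HasSpanningMonoComponent (transpose c) → HasSpanningMonoComponent c
  spanning-transpose (k , v , spans) =
    k , swap v , λ w → subst (Conn c k (swap v)) (swap-involutive w) (Conn-transpose (spans (swap w)))

  V-transpose : IsVColouring (transpose c) → IsVColouring c
  V-transpose (r , b , ((j , rj) , (i , ri)) , ((j′ , bj′) , (i′ , bi′)) , covers , side) =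
    swap r , swap b ,
    ((i , Conn-transpose ri) , (j , Conn-transpose rj)) ,
    ((i′ , Conn-transpose bi′) , (j′ , Conn-transpose bj′)) ,
    (λ w → subst (λ w → Conn c red (swap r) w ⊎ Conn c blue (swap b) w) (swap-involutive w)
                 (map-⊎ Conn-transpose Conn-transpose (covers (swap w)))) ,
    swap (map-⊎ (λ both j → both′ (both j)) (λ both i → both′ (both i)) side)
    where
    both′ : ∀ {x} → Conn (transpose c) red r x × Conn (transpose c) blue b x →
      Conn c red (swap r) (swap x) × Conn c blue (swap b) (swap x)
    both′ (rx , bx) = Conn-transpose rx , Conn-transpose bx

trivial⇒spanning⊎V : (c : Colouring (suc m) (suc n)) → ∀ k v → ¬ NonTrivial c k v →
  HasSpanningMonoComponent c ⊎ IsVColouring c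
trivial⇒spanning⊎V c k (inj₁ i) trivial =
  star⇒spanning⊎V c k i λ j → ≢⇒≡flip λ e → trivial ((i , ε) , (j , tb i j e ◅ ε))
trivial⇒spanning⊎V c k (inj₂ j) trivial =
  map-⊎ (spanning-transpose c) (V-transpose c)
    (star⇒spanning⊎V (transpose c) k j λ i → ≢⇒≡flip λ e → trivial ((i , bt i j e ◅ ε) , (j , ε)))

lemma4 : (m n : ℕ) (c : Colouring (suc m) (suc n)) →
    HasSpanningMonoComponent c ⊎ (IsVColouring c ⊎ IsSplit c)
lemma4 m n c with all⊎counterexample (NonTrivial-dec c red) | all⊎counterexample (NonTrivial-dec c blue)
... | inj₂ (v , trivial) | _ = map₂ inj₁ (trivial⇒spanning⊎V c red v trivial)
... | inj₁ _ | inj₂ (v , trivial) = map₂ inj₁ (trivial⇒spanning⊎V c blue v trivial)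
... | inj₁ nonTrivialRed | inj₁ nonTrivialBlue
  with nonTrivial⇒spanning⊎twoComponents c red (top zero) nonTrivialRed
     | nonTrivial⇒spanning⊎twoComponents c blue (top zero) nonTrivialBlue
...   | inj₁ spanning | _ = inj₁ spanning
...   | inj₂ _ | inj₁ spanning = inj₁ spanning
...   | inj₂ twoRed | inj₂ twoBlue = inj₂ (inj₂ (nonTrivial , twoRed , twoBlue))
  where
  nonTrivial : ∀ k v → NonTrivial c k v
  nonTrivial red = nonTrivialRed
  nonTrivial blue = nonTrivialBlue
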